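{- For all integers $n\geq 1$ and $p\geq 0$, \[ \sum_{k=0}^{n}\frac{k^{p}(-1)^{k}}{\binom{n}{k}}=\frac{n+1}{n+2}\left[(-1)^{n+p}B_{p,n+1}(-n)+B_{p,n+1}\right]. \]
   Context: For each integer $q\geq 0$, the $q$-Bernoulli numbers $B_{j,q}$ ($j\ge 0$) are defined by $B_{0,q}=1$ and $B_{j+1,q}=qB_{j,q}-\frac{(q+1)^{2}}{q+2}B_{j,q+1}$ ($j,q\ge 0$), and the $q$-Bernoulli polynomials by $B_{j,q}(x)=\sum_{i=0}^{j}\binom{j}{i}x^{j-i}B_{i,q}$. Thus $B_{p,n+1}$ and $B_{p,n+1}(x)$ denote the $p$-th $(n+1)$-Bernoulli number and polynomial (first index = degree, second index = parameter). The convention $0^0=1$ is used. -}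

module Defs where

open import Data.Nat as ℕ using (ℕ; zero; suc)
open import Data.Nat.Combinatorics using (_C_)
open import Data.Integer using (ℤ; +_)
open import Data.Rational using (ℚ; 0ℚ; 1ℚ; _+_; _*_; _-_; -_; _/_)

ℕtoℚ : ℕ → ℚ
ℕtoℚ m = (+ m) / 1

-- rational power x^m (with x^0 = 1, so 0^0 = 1)
_^ℚ_ : ℚ → ℕ → ℚ
x ^ℚ zero  = 1ℚ
x ^ℚ suc m = x * (x ^ℚ m)

sgn : ℕ → ℚ
sgn m = (- 1ℚ) ^ℚ m

sumTo : ℕ → (ℕ → ℚ) → ℚ
sumTo zero    f = f 0
sumTo (suc m) f = sumTo m f + f (suc m)

qBernoulli : ℕ → ℕ → ℚ
qBernoulli zero    q = 1ℚ
qBernoulli (suc j) q =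
  ℕtoℚ q * qBernoulli j q
    - ((+ ((suc q) ℕ.* (suc q))) / (suc (suc q))) * qBernoulli j (suc q)

qBernoulliPoly : ℕ → ℕ → ℚ → ℚ
qBernoulliPoly j q x =
  sumTo j (λ i → ℕtoℚ (j C i) * (x ^ℚ (j ℕ.∸ i)) * qBernoulli i q)

-- reciprocal of a natural number as a rational; only ever applied to
-- nonzero arguments (binomial coefficients C(n,k) with k ≤ n); the value
-- at 0 is an irrelevant convention
recipℕ : ℕ → ℚ
recipℕ zero    = 0ℚ
recipℕ (suc m) = (+ 1) / (suc m)

-- Put S(n,p,a) = Σ_{k=0}^{n} (k+a)^p (-1)^k / C(n,k).  From
--   k/C(n,k) = (n+1)/C(n,k) - (n+1)/C(n+1,k)  and
--   1/C(n,k) = (n+1)/(n+2) · (1/C(n+1,k) + 1/C(n+1,k+1))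
-- one gets S(n,p+1,a) = (n+1+a) S(n,p,a) - (n+1) (S(n+1,p,a) - (n+1+a)^p (-1)^(n+1))
-- and, by telescoping, S(n,0,a) = (n+1)/(n+2) (1 + (-1)^n).  The expression
-- (n+1)/(n+2) (B_{p,n+1}(a) + (-1)^(n+p) B_{p,n+1}(-n-a)) satisfies the same
-- recursion, thanks to the degree recurrence
--   B_{p+1,q}(x) = (x+q) B_{p,q}(x) - (q+1)²/(q+2) B_{p,q+1}(x)
-- and the difference equation
--   B_{p,q}(x) = (q+1)/(q+2) (B_{p,q+1}(x) - B_{p,q+1}(x-1)) + (x-1)^p.
-- Induction on p, for all n and a simultaneously, gives the closed form of
-- S(n,p,a); the theorem is the case a = 0.

module Submission where

open import Defs
open import Data.Nat as ℕ using (ℕ; zero; suc; _≤_; _<_; _≥_; _∸_; z≤n; s≤s)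
import Data.Nat.Properties as ℕ
open import Data.Nat.Combinatorics
  using (_C_; nCk+nC[k+1]≡[n+1]C[k+1]; nCn≡1; nC1≡n; k>n⇒nCk≡0)
import Data.Nat.Tactic.RingSolver as ℕ-Solver
open import Data.Integer as ℤ using (+_; 1ℤ)
import Data.Integer.Properties as ℤ
import Data.Integer.Tactic.RingSolver as ℤ-Solver
open import Data.Rational using (ℚ; 0ℚ; 1ℚ; _+_; _*_; _-_; -_; _/_; toℚᵘ)
open import Data.Rational.Properties
  using (_≟_; +-*-commutativeRing; toℚᵘ-injective; toℚᵘ-fromℚᵘ; toℚᵘ-homo-+; toℚᵘ-homo-*;
         +-identityˡ; +-identityʳ; +-inverseʳ; +-comm; +-assoc; *-zeroʳ; *-identityˡ; *-identityʳ; *-assoc; *-distribˡ-+)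
import Data.Rational.Unnormalised as ℚᵘ
import Data.Rational.Unnormalised.Properties as ℚᵘ
open import Level using (0ℓ)
open import Relation.Nullary.Decidable.Core using (dec⇒maybe)
open import Relation.Binary.PropositionalEquality
open import Tactic.RingSolver.Core.AlmostCommutativeRing
  using (AlmostCommutativeRing; fromCommutativeRing)
open import Tactic.RingSolver using (solve-∀)

ℚ-ring : AlmostCommutativeRing 0ℓ 0ℓ
ℚ-ring = fromCommutativeRing +-*-commutativeRing (λ x → dec⇒maybe (0ℚ ≟ x))

-- Linear combinations: x ≡ y follows from hypotheses lᵢ ≡ rᵢ once the ring
-- solver writes x as y + Σ cᵢ * (lᵢ - rᵢ).

vanishing : ∀ c {l r} → l ≡ r → c * (l - r) ≡ 0ℚ
vanishing c {l} refl = trans (cong (c *_) (+-inverseʳ l)) (*-zeroʳ c)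

infixr 5 _⊕_

_⊕_ : ∀ {e f} → e ≡ 0ℚ → f ≡ 0ℚ → e + f ≡ 0ℚ
refl ⊕ refl = refl

≡-by-combination : ∀ {x y e} → x ≡ y + e → e ≡ 0ℚ → x ≡ y
≡-by-combination {y = y} x≡y+e refl = trans x≡y+e (+-identityʳ y)

toℚᵘ-/ : ∀ i k → toℚᵘ (i / suc k) ℚᵘ.≃ ℚᵘ.mkℚᵘ i k
toℚᵘ-/ i k = toℚᵘ-fromℚᵘ (ℚᵘ.mkℚᵘ i k)

ℕtoℚ-+ : ∀ m n → ℕtoℚ (m ℕ.+ n) ≡ ℕtoℚ m + ℕtoℚ n
ℕtoℚ-+ m n = toℚᵘ-injective (begin
  toℚᵘ (ℕtoℚ (m ℕ.+ n))
    ≈⟨ toℚᵘ-/ (+ (m ℕ.+ n)) 0 ⟩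
  ℚᵘ.mkℚᵘ (+ (m ℕ.+ n)) 0
    ≈⟨ ℚᵘ.*≡* (trans (cong (ℤ._* (1ℤ ℤ.* 1ℤ)) (ℤ.pos-+ m n)) (ring (+ m) (+ n))) ⟩
  ℚᵘ.mkℚᵘ (+ m) 0 ℚᵘ.+ ℚᵘ.mkℚᵘ (+ n) 0
    ≈⟨ ℚᵘ.+-cong (toℚᵘ-/ (+ m) 0) (toℚᵘ-/ (+ n) 0) ⟨
  toℚᵘ (ℕtoℚ m) ℚᵘ.+ toℚᵘ (ℕtoℚ n)
    ≈⟨ toℚᵘ-homo-+ (ℕtoℚ m) (ℕtoℚ n) ⟨
  toℚᵘ (ℕtoℚ m + ℕtoℚ n)
    ∎)
  where
  open ℚᵘ.≃-Reasoning
  ring : ∀ a b → (a ℤ.+ b) ℤ.* (1ℤ ℤ.* 1ℤ) ≡ (a ℤ.* 1ℤ ℤ.+ b ℤ.* 1ℤ) ℤ.* 1ℤ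
  ring = ℤ-Solver.solve-∀

ℕtoℚ-suc : ∀ n → ℕtoℚ (suc n) ≡ 1ℚ + ℕtoℚ n
ℕtoℚ-suc = ℕtoℚ-+ 1

ℕtoℚ-*-/ : ∀ a b k → ℕtoℚ a * ((+ b) / suc k) ≡ (+ (a ℕ.* b)) / suc k
ℕtoℚ-*-/ a b k = toℚᵘ-injective (begin
  toℚᵘ (ℕtoℚ a * ((+ b) / suc k))
    ≈⟨ toℚᵘ-homo-* (ℕtoℚ a) ((+ b) / suc k) ⟩
  toℚᵘ (ℕtoℚ a) ℚᵘ.* toℚᵘ ((+ b) / suc k)
    ≈⟨ ℚᵘ.*-cong (toℚᵘ-/ (+ a) 0) (toℚᵘ-/ (+ b) k) ⟩
  ℚᵘ.mkℚᵘ (+ a) 0 ℚᵘ.* ℚᵘ.mkℚᵘ (+ b) k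
    ≈⟨ ℚᵘ.*≡* (trans (cong (ℤ._* + suc k) (sym (ℤ.pos-* a b))) (ring (+ (a ℕ.* b)) (+ suc k))) ⟩
  ℚᵘ.mkℚᵘ (+ (a ℕ.* b)) k
    ≈⟨ toℚᵘ-/ (+ (a ℕ.* b)) k ⟨
  toℚᵘ ((+ (a ℕ.* b)) / suc k)
    ∎)
  where
  open ℚᵘ.≃-Reasoning
  ring : ∀ x d → x ℤ.* d ≡ x ℤ.* (1ℤ ℤ.* d)
  ring = ℤ-Solver.solve-∀

ℕtoℚ-* : ∀ a b → ℕtoℚ (a ℕ.* b) ≡ ℕtoℚ a * ℕtoℚ b
ℕtoℚ-* a b = sym (ℕtoℚ-*-/ a b 0)

m/[1+k]*[1+k]≡m : ∀ m k → ((+ m) / suc k) * ℕtoℚ (suc k) ≡ ℕtoℚ m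
m/[1+k]*[1+k]≡m m k = toℚᵘ-injective (begin
  toℚᵘ (((+ m) / suc k) * ℕtoℚ (suc k))
    ≈⟨ toℚᵘ-homo-* ((+ m) / suc k) (ℕtoℚ (suc k)) ⟩
  toℚᵘ ((+ m) / suc k) ℚᵘ.* toℚᵘ (ℕtoℚ (suc k))
    ≈⟨ ℚᵘ.*-cong (toℚᵘ-/ (+ m) k) (toℚᵘ-/ (+ suc k) 0) ⟩
  ℚᵘ.mkℚᵘ (+ m) k ℚᵘ.* ℚᵘ.mkℚᵘ (+ suc k) 0
    ≈⟨ ℚᵘ.*≡* (ring (+ m) (+ suc k)) ⟩
  ℚᵘ.mkℚᵘ (+ m) 0
    ≈⟨ toℚᵘ-/ (+ m) 0 ⟨
  toℚᵘ (ℕtoℚ m)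
    ∎)
  where
  open ℚᵘ.≃-Reasoning
  ring : ∀ x d → (x ℤ.* d) ℤ.* 1ℤ ≡ x ℤ.* (d ℤ.* 1ℤ)
  ring = ℤ-Solver.solve-∀

recipℕ-inverseˡ : ∀ {a} → 0 < a → recipℕ a * ℕtoℚ a ≡ 1ℚ
recipℕ-inverseˡ {suc a} _ = m/[1+k]*[1+k]≡m 1 a

ratio : ℕ → ℚ
ratio q = (+ suc q) / suc (suc q)

ratio-*-[2+q] : ∀ q → ratio q * ℕtoℚ (suc (suc q)) ≡ ℕtoℚ (suc q)
ratio-*-[2+q] q = m/[1+k]*[1+k]≡m (suc q) (suc q)

pascal : ∀ n k → suc n C suc k ≡ n C k ℕ.+ n C suc k
pascal n k = sym (nCk+nC[k+1]≡[n+1]C[k+1] n k)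

nCk>0 : ∀ {n k} → k ≤ n → 0 < n C k
nCk>0 {k = zero}  _         = s≤s z≤n
nCk>0 {suc n} {suc k} (s≤s k≤n) =
  subst (0 <_) (sym (pascal n k)) (ℕ.<-≤-trans (nCk>0 k≤n) (ℕ.m≤m+n _ _))

[n+1]C[k+1]*[k+1]≡[n+1]*nCk : ∀ n k → (suc n C suc k) ℕ.* suc k ≡ suc n ℕ.* (n C k)
[n+1]C[k+1]*[k+1]≡[n+1]*nCk zero    zero    = refl
[n+1]C[k+1]*[k+1]≡[n+1]*nCk zero    (suc k) = refl
[n+1]C[k+1]*[k+1]≡[n+1]*nCk (suc n) zero    = cong (ℕ._* 1) (nC1≡n (suc (suc n)))
[n+1]C[k+1]*[k+1]≡[n+1]*nCk (suc n) (suc k) = begin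
  (suc (suc n) C suc (suc k)) ℕ.* suc (suc k)        ≡⟨ cong (ℕ._* suc (suc k)) (pascal (suc n) (suc k)) ⟩
  (u ℕ.+ v) ℕ.* suc (suc k)                          ≡⟨ ring₁ u v k ⟩
  u ℕ.* suc k ℕ.+ u ℕ.+ v ℕ.* suc (suc k)            ≡⟨ cong₂ (λ x y → x ℕ.+ u ℕ.+ y)
                                                          ([n+1]C[k+1]*[k+1]≡[n+1]*nCk n k)
                                                          ([n+1]C[k+1]*[k+1]≡[n+1]*nCk n (suc k)) ⟩
  suc n ℕ.* (n C k) ℕ.+ u ℕ.+ suc n ℕ.* (n C suc k)  ≡⟨ ring₂ (suc n) (n C k) (n C suc k) u ⟩
  suc n ℕ.* (n C k ℕ.+ n C suc k) ℕ.+ u              ≡⟨ cong (λ w → suc n ℕ.* w ℕ.+ u) (sym (pascal n k)) ⟩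
  suc n ℕ.* u ℕ.+ u                                  ≡⟨ ℕ.+-comm (suc n ℕ.* u) u ⟩
  suc (suc n) ℕ.* u                                  ∎
  where
  open ≡-Reasoning
  u = suc n C suc k
  v = suc n C suc (suc k)
  ring₁ : ∀ u v k → (u ℕ.+ v) ℕ.* suc (suc k) ≡ u ℕ.* suc k ℕ.+ u ℕ.+ v ℕ.* suc (suc k)
  ring₁ = ℕ-Solver.solve-∀
  ring₂ : ∀ a x y u → a ℕ.* x ℕ.+ u ℕ.+ a ℕ.* y ≡ a ℕ.* (x ℕ.+ y) ℕ.+ u
  ring₂ = ℕ-Solver.solve-∀

[n+1]Ck*[n+1]≡[n+1]Ck*k+[n+1]*nCk : ∀ n k →
  (suc n C k) ℕ.* suc n ≡ (suc n C k) ℕ.* k ℕ.+ suc n ℕ.* (n C k)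
[n+1]Ck*[n+1]≡[n+1]Ck*k+[n+1]*nCk n zero    = ring n
  where
  ring : ∀ n → 1 ℕ.* suc n ≡ 1 ℕ.* 0 ℕ.+ suc n ℕ.* 1
  ring = ℕ-Solver.solve-∀
[n+1]Ck*[n+1]≡[n+1]Ck*k+[n+1]*nCk n (suc k) = begin
  (suc n C suc k) ℕ.* suc n                            ≡⟨ ℕ.*-comm (suc n C suc k) (suc n) ⟩
  suc n ℕ.* (suc n C suc k)                            ≡⟨ cong (suc n ℕ.*_) (pascal n k) ⟩
  suc n ℕ.* (n C k ℕ.+ n C suc k)                      ≡⟨ ℕ.*-distribˡ-+ (suc n) (n C k) (n C suc k) ⟩
  suc n ℕ.* (n C k) ℕ.+ suc n ℕ.* (n C suc k)          ≡⟨ cong (ℕ._+ suc n ℕ.* (n C suc k))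
                                                            (sym ([n+1]C[k+1]*[k+1]≡[n+1]*nCk n k)) ⟩
  (suc n C suc k) ℕ.* suc k ℕ.+ suc n ℕ.* (n C suc k)  ∎
  where open ≡-Reasoning

recipℕ-C-split : ∀ {n k} → k ≤ n →
  ℕtoℚ (suc n) * recipℕ (suc n C k) + ℕtoℚ k * recipℕ (n C k) ≡ ℕtoℚ (suc n) * recipℕ (n C k)
recipℕ-C-split {n} {k} k≤n = ≡-by-combination (ring N₁ K rA rB A B)
  (vanishing (- (rA * rB)) split ⊕ vanishing (rB * N₁ - rB * K) rA*A≡1 ⊕ vanishing (- (rA * N₁)) rB*B≡1)
  where
  N₁ = ℕtoℚ (suc n)
  K  = ℕtoℚ k
  A  = ℕtoℚ (suc n C k)
  B  = ℕtoℚ (n C k)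
  rA = recipℕ (suc n C k)
  rB = recipℕ (n C k)
  rA*A≡1 : rA * A ≡ 1ℚ
  rA*A≡1 = recipℕ-inverseˡ (nCk>0 (ℕ.m≤n⇒m≤1+n k≤n))
  rB*B≡1 : rB * B ≡ 1ℚ
  rB*B≡1 = recipℕ-inverseˡ (nCk>0 k≤n)
  split : A * N₁ ≡ A * K + N₁ * B
  split = begin
    A * N₁
      ≡⟨ ℕtoℚ-* (suc n C k) (suc n) ⟨
    ℕtoℚ ((suc n C k) ℕ.* suc n)
      ≡⟨ cong ℕtoℚ ([n+1]Ck*[n+1]≡[n+1]Ck*k+[n+1]*nCk n k) ⟩
    ℕtoℚ ((suc n C k) ℕ.* k ℕ.+ suc n ℕ.* (n C k))
      ≡⟨ ℕtoℚ-+ ((suc n C k) ℕ.* k) (suc n ℕ.* (n C k)) ⟩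
    ℕtoℚ ((suc n C k) ℕ.* k) + ℕtoℚ (suc n ℕ.* (n C k))
      ≡⟨ cong₂ _+_ (ℕtoℚ-* (suc n C k) k) (ℕtoℚ-* (suc n) (n C k)) ⟩
    A * K + N₁ * B
      ∎
    where open ≡-Reasoning
  ring : ∀ N₁ K rA rB A B → N₁ * rA + K * rB ≡ N₁ * rB
    + ((- (rA * rB)) * (A * N₁ - (A * K + N₁ * B))
    + ((rB * N₁ - rB * K) * (rA * A - 1ℚ) + (- (rA * N₁)) * (rB * B - 1ℚ)))
  ring = solve-∀ ℚ-ring

recipℕ-C-absorb : ∀ {n k} → k ≤ n →
  ℕtoℚ (suc n) * recipℕ (suc n C suc k) ≡ ℕtoℚ (suc k) * recipℕ (n C k)
recipℕ-C-absorb {n} {k} k≤n = ≡-by-combination (ring N₁ K₁ rA rB A B)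
  (vanishing (K₁ * rB) rA*A≡1 ⊕ vanishing (- (rA * rB)) absorb ⊕ vanishing (- (N₁ * rA)) rB*B≡1)
  where
  N₁ = ℕtoℚ (suc n)
  K₁ = ℕtoℚ (suc k)
  A  = ℕtoℚ (suc n C suc k)
  B  = ℕtoℚ (n C k)
  rA = recipℕ (suc n C suc k)
  rB = recipℕ (n C k)
  rA*A≡1 : rA * A ≡ 1ℚ
  rA*A≡1 = recipℕ-inverseˡ (nCk>0 (s≤s k≤n))
  rB*B≡1 : rB * B ≡ 1ℚ
  rB*B≡1 = recipℕ-inverseˡ (nCk>0 k≤n)
  absorb : A * K₁ ≡ N₁ * B
  absorb = begin
    A * K₁                               ≡⟨ ℕtoℚ-* (suc n C suc k) (suc k) ⟨
    ℕtoℚ ((suc n C suc k) ℕ.* suc k)      ≡⟨ cong ℕtoℚ ([n+1]C[k+1]*[k+1]≡[n+1]*nCk n k) ⟩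
    ℕtoℚ (suc n ℕ.* (n C k))              ≡⟨ ℕtoℚ-* (suc n) (n C k) ⟩
    N₁ * B                               ∎
    where open ≡-Reasoning
  ring : ∀ N₁ K₁ rA rB A B → N₁ * rA ≡ K₁ * rB
    + ((K₁ * rB) * (rA * A - 1ℚ)
    + ((- (rA * rB)) * (A * K₁ - N₁ * B) + (- (N₁ * rA)) * (rB * B - 1ℚ)))
  ring = solve-∀ ℚ-ring

recipℕ-C-pascal : ∀ {n k} → k ≤ n →
  ratio n * (recipℕ (suc n C k) + recipℕ (suc n C suc k)) ≡ recipℕ (n C k)
recipℕ-C-pascal {n} {k} k≤n = ≡-by-combination (ring d N₁ N₂ K rA rA′ rB rN₁)
  (vanishing (rN₁ * d) (recipℕ-C-split k≤n)
   ⊕ vanishing (rN₁ * d) absorb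
   ⊕ vanishing (rN₁ * rB) (ratio-*-[2+q] n)
   ⊕ vanishing (- (rN₁ * d * rB)) (ℕtoℚ-suc (suc n))
   ⊕ vanishing (- (d * (rA + rA′) - rB)) (recipℕ-inverseˡ (s≤s (z≤n {n}))))
  where
  d   = ratio n
  N₁  = ℕtoℚ (suc n)
  N₂  = ℕtoℚ (suc (suc n))
  K   = ℕtoℚ k
  rA  = recipℕ (suc n C k)
  rA′ = recipℕ (suc n C suc k)
  rB  = recipℕ (n C k)
  rN₁ = recipℕ (suc n)
  absorb : N₁ * rA′ ≡ (1ℚ + K) * rB
  absorb = trans (recipℕ-C-absorb k≤n) (cong (_* rB) (ℕtoℚ-suc k))
  ring : ∀ d N₁ N₂ K rA rA′ rB rN₁ → d * (rA + rA′) ≡ rB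
    + ((rN₁ * d) * ((N₁ * rA + K * rB) - N₁ * rB)
    + ((rN₁ * d) * (N₁ * rA′ - (1ℚ + K) * rB)
    + ((rN₁ * rB) * (d * N₂ - N₁)
    + ((- (rN₁ * d * rB)) * (N₂ - (1ℚ + N₁))
    + (- (d * (rA + rA′) - rB)) * (rN₁ * N₁ - 1ℚ)))))
  ring = solve-∀ ℚ-ring

sgn-+ : ∀ m n → sgn (m ℕ.+ n) ≡ sgn m * sgn n
sgn-+ zero    n = sym (*-identityˡ (sgn n))
sgn-+ (suc m) n = trans (cong (- 1ℚ *_) (sgn-+ m n)) (sym (*-assoc (- 1ℚ) (sgn m) (sgn n)))

sgn*sgn≡1 : ∀ m → sgn m * sgn m ≡ 1ℚ
sgn*sgn≡1 zero    = refl
sgn*sgn≡1 (suc m) = trans (ring (sgn m)) (sgn*sgn≡1 m)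
  where
  ring : ∀ s → (- 1ℚ * s) * (- 1ℚ * s) ≡ s * s
  ring = solve-∀ ℚ-ring

sgn[m+n]*sgn[n]≡sgn[m] : ∀ m n → sgn (m ℕ.+ n) * sgn n ≡ sgn m
sgn[m+n]*sgn[n]≡sgn[m] m n = begin
  sgn (m ℕ.+ n) * sgn n        ≡⟨ cong (_* sgn n) (sgn-+ m n) ⟩
  sgn m * sgn n * sgn n        ≡⟨ *-assoc (sgn m) (sgn n) (sgn n) ⟩
  sgn m * (sgn n * sgn n)      ≡⟨ cong (sgn m *_) (sgn*sgn≡1 n) ⟩
  sgn m * 1ℚ                   ≡⟨ *-identityʳ (sgn m) ⟩
  sgn m                        ∎
  where open ≡-Reasoning

[-x]^p≡sgn[p]*x^p : ∀ x p → (- x) ^ℚ p ≡ sgn p * x ^ℚ p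
[-x]^p≡sgn[p]*x^p x zero    = refl
[-x]^p≡sgn[p]*x^p x (suc p) = trans (cong ((- x) *_) ([-x]^p≡sgn[p]*x^p x p)) (ring x (sgn p) (x ^ℚ p))
  where
  ring : ∀ x s y → (- x) * (s * y) ≡ (- 1ℚ * s) * (x * y)
  ring = solve-∀ ℚ-ring

sumTo-cong : ∀ n {f g : ℕ → ℚ} → (∀ k → k ≤ n → f k ≡ g k) → sumTo n f ≡ sumTo n g
sumTo-cong zero    f≗g = f≗g 0 z≤n
sumTo-cong (suc n) f≗g =
  cong₂ _+_ (sumTo-cong n (λ k k≤n → f≗g k (ℕ.m≤n⇒m≤1+n k≤n))) (f≗g (suc n) ℕ.≤-refl)

sumTo-zero : ∀ n {f : ℕ → ℚ} → (∀ k → k ≤ n → f k ≡ 0ℚ) → sumTo n f ≡ 0ℚ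
sumTo-zero zero    f≡0 = f≡0 0 z≤n
sumTo-zero (suc n) f≡0 = sumTo-zero n (λ k k≤n → f≡0 k (ℕ.m≤n⇒m≤1+n k≤n)) ⊕ f≡0 (suc n) ℕ.≤-refl

sumTo-+ : ∀ n (f g : ℕ → ℚ) → sumTo n (λ k → f k + g k) ≡ sumTo n f + sumTo n g
sumTo-+ zero    f g = refl
sumTo-+ (suc n) f g = trans (cong (_+ (f (suc n) + g (suc n))) (sumTo-+ n f g))
  (ring (sumTo n f) (sumTo n g) (f (suc n)) (g (suc n)))
  where
  ring : ∀ F G x y → (F + G) + (x + y) ≡ (F + x) + (G + y)
  ring = solve-∀ ℚ-ring

sumTo-* : ∀ n c (f : ℕ → ℚ) → sumTo n (λ k → c * f k) ≡ c * sumTo n f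
sumTo-* zero    c f = refl
sumTo-* (suc n) c f = trans (cong (_+ (c * f (suc n))) (sumTo-* n c f))
  (sym (*-distribˡ-+ c (sumTo n f) (f (suc n))))

sumTo-linear : ∀ n u v (f g : ℕ → ℚ) →
  sumTo n (λ k → u * f k - v * g k) ≡ u * sumTo n f - v * sumTo n g
sumTo-linear zero    u v f g = refl
sumTo-linear (suc n) u v f g = trans (cong (_+ (u * f (suc n) - v * g (suc n))) (sumTo-linear n u v f g))
  (ring u v (sumTo n f) (sumTo n g) (f (suc n)) (g (suc n)))
  where
  ring : ∀ u v F G x y → (u * F - v * G) + (u * x - v * y) ≡ u * (F + x) - v * (G + y)
  ring = solve-∀ ℚ-ring

sumTo-suc : ∀ n (f : ℕ → ℚ) → sumTo (suc n) f ≡ f 0 + sumTo n (λ k → f (suc k))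
sumTo-suc zero    f = refl
sumTo-suc (suc n) f = trans (cong (_+ f (suc (suc n))) (sumTo-suc n f)) (+-assoc (f 0) _ _)

sumTo-alternating-telescope : ∀ n (f : ℕ → ℚ) →
  sumTo n (λ k → sgn k * (f k + f (suc k))) ≡ f 0 + sgn n * f (suc n)
sumTo-alternating-telescope zero    f = ring (f 0) (f 1)
  where
  ring : ∀ x y → 1ℚ * (x + y) ≡ x + 1ℚ * y
  ring = solve-∀ ℚ-ring
sumTo-alternating-telescope (suc n) f =
  trans (cong (_+ (sgn (suc n) * (f (suc n) + f (suc (suc n))))) (sumTo-alternating-telescope n f))
        (ring (f 0) (sgn n) (f (suc n)) (f (suc (suc n))))
  where
  ring : ∀ x s y z → (x + s * y) + (- 1ℚ * s) * (y + z) ≡ x + (- 1ℚ * s) * z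
  ring = solve-∀ ℚ-ring

qBernoulli-term : ℕ → ℕ → ℚ → ℕ → ℚ
qBernoulli-term p q x i = ℕtoℚ (p C i) * (x ^ℚ (p ∸ i)) * qBernoulli i q

qBernoulliPoly-suc : ∀ p q x → qBernoulliPoly (suc p) q x
  ≡ (x + ℕtoℚ q) * qBernoulliPoly p q x - (ℕtoℚ (suc q) * ratio q) * qBernoulliPoly p (suc q) x
qBernoulliPoly-suc p q x = begin
  qBernoulliPoly (suc p) q x
    ≡⟨ sumTo-suc p (qBernoulli-term (suc p) q x) ⟩
  V 0 + sumTo p (λ j → qBernoulli-term (suc p) q x (suc j))
    ≡⟨ cong (_+_ (V 0)) (sumTo-cong p (λ j _ → pascal-step j)) ⟩
  V 0 + sumTo p (λ j → (Q * T j - c * T′ j) + V (suc j))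
    ≡⟨ cong (_+_ (V 0)) (trans (sumTo-+ p (λ j → Q * T j - c * T′ j) (λ j → V (suc j)))
                            (cong (_+ sumTo p (λ j → V (suc j))) (sumTo-linear p Q c T T′))) ⟩
  V 0 + ((Q * Pq - c * Pq′) + sumTo p (λ j → V (suc j)))
    ≡⟨ ring₁ (V 0) (sumTo p (λ j → V (suc j))) (Q * Pq - c * Pq′) ⟩
  (V 0 + sumTo p (λ j → V (suc j))) + (Q * Pq - c * Pq′)
    ≡⟨ cong (_+ (Q * Pq - c * Pq′)) ΣV≡x*Pq ⟩
  x * Pq + (Q * Pq - c * Pq′)
    ≡⟨ ring₂ x Q Pq (c * Pq′) ⟩
  (x + Q) * Pq - c * Pq′
    ≡⟨ cong (λ c → (x + Q) * Pq - c * Pq′) (sym (ℕtoℚ-*-/ (suc q) (suc q) (suc q))) ⟩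
  (x + Q) * Pq - (ℕtoℚ (suc q) * ratio q) * Pq′
    ∎
  where
  open ≡-Reasoning
  Q   = ℕtoℚ q
  c   = (+ (suc q ℕ.* suc q)) / suc (suc q)
  T   = qBernoulli-term p q x
  T′  = qBernoulli-term p (suc q) x
  Pq  = qBernoulliPoly p q x
  Pq′ = qBernoulliPoly p (suc q) x
  V : ℕ → ℚ
  V i = ℕtoℚ (p C i) * (x ^ℚ (suc p ∸ i)) * qBernoulli i q
  pascal-step : ∀ j → qBernoulli-term (suc p) q x (suc j) ≡ (Q * T j - c * T′ j) + V (suc j)
  pascal-step j = begin
    ℕtoℚ (suc p C suc j) * X * (Q * Bj - c * Bj′)
      ≡⟨ cong (λ m → ℕtoℚ m * X * (Q * Bj - c * Bj′)) (pascal p j) ⟩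
    ℕtoℚ (p C j ℕ.+ p C suc j) * X * (Q * Bj - c * Bj′)
      ≡⟨ cong (λ y → y * X * (Q * Bj - c * Bj′)) (ℕtoℚ-+ (p C j) (p C suc j)) ⟩
    (ℕtoℚ (p C j) + ℕtoℚ (p C suc j)) * X * (Q * Bj - c * Bj′)
      ≡⟨ ring (ℕtoℚ (p C j)) (ℕtoℚ (p C suc j)) X Q Bj Bj′ c ⟩
    (Q * T j - c * T′ j) + V (suc j)
      ∎
    where
    X   = x ^ℚ (p ∸ j)
    Bj  = qBernoulli j q
    Bj′ = qBernoulli j (suc q)
    ring : ∀ a b X Q B B′ c → (a + b) * X * (Q * B - c * B′)
                            ≡ (Q * (a * X * B) - c * (a * X * B′)) + b * X * (Q * B - c * B′)
    ring = solve-∀ ℚ-ring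
  V≡x*T : ∀ i → i ≤ p → V i ≡ x * T i
  V≡x*T i i≤p = trans (cong (λ e → ℕtoℚ (p C i) * (x ^ℚ e) * qBernoulli i q) (ℕ.+-∸-assoc 1 i≤p))
                      (ring (ℕtoℚ (p C i)) x (x ^ℚ (p ∸ i)) (qBernoulli i q))
    where
    ring : ∀ a x X B → a * (x * X) * B ≡ x * (a * X * B)
    ring = solve-∀ ℚ-ring
  V[1+p]≡0 : V (suc p) ≡ 0ℚ
  V[1+p]≡0 = trans (cong (λ m → ℕtoℚ m * (x ^ℚ (p ∸ p)) * qBernoulli (suc p) q) (k>n⇒nCk≡0 (ℕ.n<1+n p)))
                   (ring (x ^ℚ (p ∸ p)) (qBernoulli (suc p) q))
    where
    ring : ∀ X B → 0ℚ * X * B ≡ 0ℚ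
    ring = solve-∀ ℚ-ring
  ΣV≡x*Pq : V 0 + sumTo p (λ j → V (suc j)) ≡ x * Pq
  ΣV≡x*Pq = begin
    V 0 + sumTo p (λ j → V (suc j))  ≡⟨ sumTo-suc p V ⟨
    sumTo p V + V (suc p)            ≡⟨ cong (λ v → sumTo p V + v) V[1+p]≡0 ⟩
    sumTo p V + 0ℚ                   ≡⟨ +-identityʳ (sumTo p V) ⟩
    sumTo p V                        ≡⟨ sumTo-cong p V≡x*T ⟩
    sumTo p (λ i → x * T i)          ≡⟨ sumTo-* p x T ⟩
    x * Pq                           ∎
  ring₁ : ∀ v s e → v + (e + s) ≡ (v + s) + e
  ring₁ = solve-∀ ℚ-ring
  ring₂ : ∀ x Q P e → x * P + (Q * P - e) ≡ (x + Q) * P - e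
  ring₂ = solve-∀ ℚ-ring

qBernoulliPoly-0 : ∀ p q → qBernoulliPoly p q 0ℚ ≡ qBernoulli p q
qBernoulliPoly-0 zero    q = refl
qBernoulliPoly-0 (suc p) q = begin
  sumTo p (qBernoulli-term (suc p) q 0ℚ) + qBernoulli-term (suc p) q 0ℚ (suc p)
    ≡⟨ cong₂ _+_ (sumTo-zero p lower-terms-vanish) leading-term ⟩
  0ℚ + qBernoulli (suc p) q
    ≡⟨ +-identityˡ (qBernoulli (suc p) q) ⟩
  qBernoulli (suc p) q
    ∎
  where
  open ≡-Reasoning
  lower-terms-vanish : ∀ i → i ≤ p → qBernoulli-term (suc p) q 0ℚ i ≡ 0ℚ
  lower-terms-vanish i i≤p =
    trans (cong (λ e → ℕtoℚ (suc p C i) * (0ℚ ^ℚ e) * qBernoulli i q) (ℕ.+-∸-assoc 1 i≤p))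
          (ring (ℕtoℚ (suc p C i)) (0ℚ ^ℚ (p ∸ i)) (qBernoulli i q))
    where
    ring : ∀ a X B → a * (0ℚ * X) * B ≡ 0ℚ
    ring = solve-∀ ℚ-ring
  leading-term : qBernoulli-term (suc p) q 0ℚ (suc p) ≡ qBernoulli (suc p) q
  leading-term =
    trans (cong₂ (λ m e → ℕtoℚ m * (0ℚ ^ℚ e) * qBernoulli (suc p) q) (nCn≡1 (suc p)) (ℕ.n∸n≡0 p))
          (ring (qBernoulli (suc p) q))
    where
    ring : ∀ B → 1ℚ * 1ℚ * B ≡ B
    ring = solve-∀ ℚ-ring

qBernoulliPoly-difference : ∀ p q x → qBernoulliPoly p q x
  ≡ ratio q * (qBernoulliPoly p (suc q) x - qBernoulliPoly p (suc q) (x - 1ℚ)) + (x - 1ℚ) ^ℚ p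
qBernoulliPoly-difference zero    q x = ring (ratio q)
  where
  ring : ∀ d → 1ℚ ≡ d * (1ℚ - 1ℚ) + 1ℚ
  ring = solve-∀ ℚ-ring
qBernoulliPoly-difference (suc p) q x = begin
  qBernoulliPoly (suc p) q x
    ≡⟨ qBernoulliPoly-suc p q x ⟩
  (x + Q) * Bq - (N₁ * d₀) * B₁
    ≡⟨ ≡-by-combination (ring x Q N₁ N₂ d₀ d₁ Bq B₁ B₁⁻ B₂ B₂⁻ y)
         (vanishing (x + Q) (qBernoulliPoly-difference p q x)
          ⊕ vanishing (- (d₀ * N₂)) (qBernoulliPoly-difference p (suc q) x)
          ⊕ vanishing (- y) (ratio-*-[2+q] q)
          ⊕ vanishing (d₀ * (B₁⁻ - B₁) - y) (ℕtoℚ-suc q)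
          ⊕ vanishing (d₀ * B₁) (ℕtoℚ-suc (suc q))) ⟩
  d₀ * (((x + N₁) * B₁ - (N₂ * d₁) * B₂) - (((x - 1ℚ) + N₁) * B₁⁻ - (N₂ * d₁) * B₂⁻)) + (x - 1ℚ) * y
    ≡⟨ cong₂ (λ u v → d₀ * (u - v) + (x - 1ℚ) * y)
             (qBernoulliPoly-suc p (suc q) x) (qBernoulliPoly-suc p (suc q) (x - 1ℚ)) ⟨
  d₀ * (qBernoulliPoly (suc p) (suc q) x - qBernoulliPoly (suc p) (suc q) (x - 1ℚ)) + (x - 1ℚ) ^ℚ suc p
    ∎
  where
  open ≡-Reasoning
  Q   = ℕtoℚ q
  N₁  = ℕtoℚ (suc q)
  N₂  = ℕtoℚ (suc (suc q))
  d₀  = ratio q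
  d₁  = ratio (suc q)
  Bq  = qBernoulliPoly p q x
  B₁  = qBernoulliPoly p (suc q) x
  B₁⁻ = qBernoulliPoly p (suc q) (x - 1ℚ)
  B₂  = qBernoulliPoly p (suc (suc q)) x
  B₂⁻ = qBernoulliPoly p (suc (suc q)) (x - 1ℚ)
  y   = (x - 1ℚ) ^ℚ p
  ring : ∀ x Q N₁ N₂ d₀ d₁ Bq B₁ B₁⁻ B₂ B₂⁻ y →
    (x + Q) * Bq - (N₁ * d₀) * B₁
      ≡ (d₀ * (((x + N₁) * B₁ - (N₂ * d₁) * B₂) - (((x - 1ℚ) + N₁) * B₁⁻ - (N₂ * d₁) * B₂⁻))
         + (x - 1ℚ) * y)
      + ((x + Q) * (Bq - (d₀ * (B₁ - B₁⁻) + y))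
      + ((- (d₀ * N₂)) * (B₁ - (d₁ * (B₂ - B₂⁻) + y))
      + ((- y) * (d₀ * N₂ - N₁)
      + ((d₀ * (B₁⁻ - B₁) - y) * (N₁ - (1ℚ + Q))
      + (d₀ * B₁) * (N₂ - (1ℚ + N₁))))))
  ring = solve-∀ ℚ-ring

altRecipSum : ℕ → ℕ → ℚ → ℚ
altRecipSum n p a = sumTo n (λ k → ((ℕtoℚ k + a) ^ℚ p) * sgn k * recipℕ (n C k))

altRecipSum-suc-power : ∀ n p a → altRecipSum n (suc p) a
  ≡ (ℕtoℚ (suc n) + a) * altRecipSum n p a
    - ℕtoℚ (suc n) * (altRecipSum (suc n) p a - ((ℕtoℚ (suc n) + a) ^ℚ p) * sgn (suc n))
altRecipSum-suc-power n p a = begin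
  altRecipSum n (suc p) a
    ≡⟨ sumTo-cong n split-term ⟩
  sumTo n (λ k → (N₁ + a) * f k - N₁ * g k)
    ≡⟨ sumTo-linear n (N₁ + a) N₁ f g ⟩
  (N₁ + a) * altRecipSum n p a - N₁ * sumTo n g
    ≡⟨ cong (λ s → (N₁ + a) * altRecipSum n p a - N₁ * s) drop-last-term ⟩
  (N₁ + a) * altRecipSum n p a - N₁ * (altRecipSum (suc n) p a - ((N₁ + a) ^ℚ p) * sgn (suc n))
    ∎
  where
  open ≡-Reasoning
  N₁ = ℕtoℚ (suc n)
  f g : ℕ → ℚ
  f k = ((ℕtoℚ k + a) ^ℚ p) * sgn k * recipℕ (n C k)
  g k = ((ℕtoℚ k + a) ^ℚ p) * sgn k * recipℕ (suc n C k)
  split-term : ∀ k → k ≤ n →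
    ((ℕtoℚ k + a) ^ℚ suc p) * sgn k * recipℕ (n C k) ≡ (N₁ + a) * f k - N₁ * g k
  split-term k k≤n = ≡-by-combination
    (ring (ℕtoℚ k) a N₁ ((ℕtoℚ k + a) ^ℚ p) (sgn k) (recipℕ (suc n C k)) (recipℕ (n C k)))
    (vanishing (((ℕtoℚ k + a) ^ℚ p) * sgn k) (recipℕ-C-split k≤n))
    where
    ring : ∀ K a N₁ Y s rA rB → ((K + a) * Y) * s * rB
      ≡ ((N₁ + a) * (Y * s * rB) - N₁ * (Y * s * rA)) + (Y * s) * ((N₁ * rA + K * rB) - N₁ * rB)
    ring = solve-∀ ℚ-ring
  lastTerm = ((N₁ + a) ^ℚ p) * sgn (suc n)
  drop-last-term : sumTo n g ≡ altRecipSum (suc n) p a - lastTerm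
  drop-last-term = begin
    sumTo n g
      ≡⟨ ring (sumTo n g) (g (suc n)) ⟩
    (sumTo n g + g (suc n)) - g (suc n)
      ≡⟨ cong (λ m → altRecipSum (suc n) p a - lastTerm * recipℕ m) (nCn≡1 (suc n)) ⟩
    altRecipSum (suc n) p a - lastTerm * 1ℚ
      ≡⟨ cong (λ t → altRecipSum (suc n) p a - t) (*-identityʳ lastTerm) ⟩
    altRecipSum (suc n) p a - lastTerm
      ∎
    where
    ring : ∀ G L → G ≡ (G + L) - L
    ring = solve-∀ ℚ-ring

altRecipSum-zero-power : ∀ n a → altRecipSum n 0 a ≡ ratio n * (1ℚ + sgn n * 1ℚ)
altRecipSum-zero-power n a = begin
  altRecipSum n 0 a
    ≡⟨ sumTo-cong n pascal-term ⟩
  sumTo n (λ k → sgn k * (f k + f (suc k)))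
    ≡⟨ sumTo-alternating-telescope n f ⟩
  d * 1ℚ + sgn n * (d * recipℕ (suc n C suc n))
    ≡⟨ cong (λ m → d * 1ℚ + sgn n * (d * recipℕ m)) (nCn≡1 (suc n)) ⟩
  d * 1ℚ + sgn n * (d * 1ℚ)
    ≡⟨ ring d (sgn n) ⟩
  d * (1ℚ + sgn n * 1ℚ)
    ∎
  where
  open ≡-Reasoning
  d = ratio n
  f : ℕ → ℚ
  f k = d * recipℕ (suc n C k)
  pascal-term : ∀ k → k ≤ n → 1ℚ * sgn k * recipℕ (n C k) ≡ sgn k * (f k + f (suc k))
  pascal-term k k≤n = ≡-by-combination
    (ring′ (sgn k) (recipℕ (n C k)) d (recipℕ (suc n C k)) (recipℕ (suc n C suc k)))
    (vanishing (- sgn k) (recipℕ-C-pascal k≤n))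
    where
    ring′ : ∀ s rB d rA rA′ → 1ℚ * s * rB ≡ s * (d * rA + d * rA′) + (- s) * (d * (rA + rA′) - rB)
    ring′ = solve-∀ ℚ-ring
  ring : ∀ d s → d * 1ℚ + s * (d * 1ℚ) ≡ d * (1ℚ + s * 1ℚ)
  ring = solve-∀ ℚ-ring

altRecipSum-closed-form : ∀ p n a → altRecipSum n p a
  ≡ ratio n * (qBernoulliPoly p (suc n) a + sgn (n ℕ.+ p) * qBernoulliPoly p (suc n) ((- ℕtoℚ n) - a))
altRecipSum-closed-form zero    n a =
  trans (altRecipSum-zero-power n a) (cong (λ m → ratio n * (1ℚ + sgn m * 1ℚ)) (sym (ℕ.+-identityʳ n)))
altRecipSum-closed-form (suc p) n a = begin
  altRecipSum n (suc p) a
    ≡⟨ altRecipSum-suc-power n p a ⟩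
  (N₁ + a) * altRecipSum n p a - N₁ * (altRecipSum (suc n) p a - y * (- 1ℚ * sₙ))
    ≡⟨ cong₂ (λ u v → (N₁ + a) * u - N₁ * (v - y * (- 1ℚ * sₙ)))
             (altRecipSum-closed-form p n a) (altRecipSum-closed-form p (suc n) a) ⟩
  (N₁ + a) * (d₀ * (Pa + s * Pb)) - N₁ * (d₁ * (P₂a + (- 1ℚ * s) * P₂c) - y * (- 1ℚ * sₙ))
    ≡⟨ ≡-by-combination (ring N N₁ N₂ a s sₚ sₙ d₀ d₁ Pa Pb P₂a P₂b P₂c y)
         (vanishing (s * d₀ * Pb) (ℕtoℚ-suc n)
          ⊕ vanishing (- (s * d₀ * Pb)) (ℕtoℚ-suc (suc n))
          ⊕ vanishing (s * Pb + d₁ * P₂a - s * d₁ * P₂b) (ratio-*-[2+q] n)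
          ⊕ vanishing (N₁ * y) (sgn[m+n]*sgn[n]≡sgn[m] n p)
          ⊕ vanishing (s * N₁) Pb-difference) ⟩
  d₀ * (((a + N₁) * Pa - (N₂ * d₁) * P₂a) + (- 1ℚ * s) * ((b + N₁) * Pb - (N₂ * d₁) * P₂b))
    ≡⟨ cong₂ (λ u v → d₀ * (u + (- 1ℚ * s) * v))
             (qBernoulliPoly-suc p (suc n) a) (qBernoulliPoly-suc p (suc n) b) ⟨
  d₀ * (qBernoulliPoly (suc p) (suc n) a + sgn (suc (n ℕ.+ p)) * qBernoulliPoly (suc p) (suc n) b)
    ≡⟨ cong (λ m → d₀ * (qBernoulliPoly (suc p) (suc n) a + sgn m * qBernoulliPoly (suc p) (suc n) b))
            (ℕ.+-suc n p) ⟨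
  d₀ * (qBernoulliPoly (suc p) (suc n) a + sgn (n ℕ.+ suc p) * qBernoulliPoly (suc p) (suc n) b)
    ∎
  where
  open ≡-Reasoning
  N   = ℕtoℚ n
  N₁  = ℕtoℚ (suc n)
  N₂  = ℕtoℚ (suc (suc n))
  b   = (- N) - a
  s   = sgn (n ℕ.+ p)
  sₚ  = sgn p
  sₙ  = sgn n
  d₀  = ratio n
  d₁  = ratio (suc n)
  y   = (N₁ + a) ^ℚ p
  Pa  = qBernoulliPoly p (suc n) a
  Pb  = qBernoulliPoly p (suc n) b
  P₂a = qBernoulliPoly p (suc (suc n)) a
  P₂b = qBernoulliPoly p (suc (suc n)) b
  P₂c = qBernoulliPoly p (suc (suc n)) ((- N₁) - a)
  b-1≡-N₁-a : b - 1ℚ ≡ (- N₁) - a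
  b-1≡-N₁-a = trans (ring N a) (cong (λ t → (- t) - a) (sym (ℕtoℚ-suc n)))
    where
    ring : ∀ N a → ((- N) - a) - 1ℚ ≡ (- (1ℚ + N)) - a
    ring = solve-∀ ℚ-ring
  Pb-difference : Pb ≡ d₁ * (P₂b - P₂c) + sₚ * y
  Pb-difference = begin
    Pb
      ≡⟨ qBernoulliPoly-difference p (suc n) b ⟩
    d₁ * (P₂b - qBernoulliPoly p (suc (suc n)) (b - 1ℚ)) + (b - 1ℚ) ^ℚ p
      ≡⟨ cong (λ t → d₁ * (P₂b - qBernoulliPoly p (suc (suc n)) t) + t ^ℚ p) b-1≡-N₁-a ⟩
    d₁ * (P₂b - P₂c) + ((- N₁) - a) ^ℚ p
      ≡⟨ cong (λ t → d₁ * (P₂b - P₂c) + t ^ℚ p) (ring N₁ a) ⟩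
    d₁ * (P₂b - P₂c) + (- (N₁ + a)) ^ℚ p
      ≡⟨ cong (λ t → d₁ * (P₂b - P₂c) + t) ([-x]^p≡sgn[p]*x^p (N₁ + a) p) ⟩
    d₁ * (P₂b - P₂c) + sₚ * y
      ∎
    where
    ring : ∀ N₁ a → (- N₁) - a ≡ - (N₁ + a)
    ring = solve-∀ ℚ-ring
  ring : ∀ N N₁ N₂ a s sₚ sₙ d₀ d₁ Pa Pb P₂a P₂b P₂c y →
    (N₁ + a) * (d₀ * (Pa + s * Pb)) - N₁ * (d₁ * (P₂a + (- 1ℚ * s) * P₂c) - y * (- 1ℚ * sₙ))
      ≡ d₀ * (((a + N₁) * Pa - (N₂ * d₁) * P₂a) + (- 1ℚ * s) * ((((- N) - a) + N₁) * Pb - (N₂ * d₁) * P₂b))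
      + ((s * d₀ * Pb) * (N₁ - (1ℚ + N))
      + ((- (s * d₀ * Pb)) * (N₂ - (1ℚ + N₁))
      + ((s * Pb + d₁ * P₂a - s * d₁ * P₂b) * (d₀ * N₂ - N₁)
      + ((N₁ * y) * (s * sₚ - sₙ)
      + (s * N₁) * (Pb - (d₁ * (P₂b - P₂c) + sₚ * y))))))
  ring = solve-∀ ℚ-ring

theorem5 : (n p : ℕ) → n ≥ 1 →
    sumTo n (λ k → (ℕtoℚ k ^ℚ p) * sgn k * recipℕ (n C k))
      ≡ ((+ (suc n)) / (suc (suc n)))
          * (sgn (n ℕ.+ p) * qBernoulliPoly p (suc n) (- ℕtoℚ n)
             + qBernoulli p (suc n))
theorem5 n p _ = begin
  sumTo n (λ k → (ℕtoℚ k ^ℚ p) * sgn k * recipℕ (n C k))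
    ≡⟨ sumTo-cong n (λ k _ → cong (λ t → (t ^ℚ p) * sgn k * recipℕ (n C k)) (sym (+-identityʳ (ℕtoℚ k)))) ⟩
  altRecipSum n p 0ℚ
    ≡⟨ altRecipSum-closed-form p n 0ℚ ⟩
  ratio n * (qBernoulliPoly p (suc n) 0ℚ + s * qBernoulliPoly p (suc n) ((- ℕtoℚ n) - 0ℚ))
    ≡⟨ cong₂ (λ u t → ratio n * (u + s * qBernoulliPoly p (suc n) t))
             (qBernoulliPoly-0 p (suc n)) (+-identityʳ (- ℕtoℚ n)) ⟩
  ratio n * (qBernoulli p (suc n) + s * qBernoulliPoly p (suc n) (- ℕtoℚ n))
    ≡⟨ cong (ratio n *_) (+-comm (qBernoulli p (suc n)) (s * qBernoulliPoly p (suc n) (- ℕtoℚ n))) ⟩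
  ratio n * (s * qBernoulliPoly p (suc n) (- ℕtoℚ n) + qBernoulli p (suc n))
    ∎
  where
  open ≡-Reasoning
  s = sgn (n ℕ.+ p)
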